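{- Let $A_0(n):=1$ for all $n\in\mathbb{N}$, and for $r\in\mathbb{N}$ let $A_r(n):=\frac{1}{n^r}\sum_{k_1,\ldots,k_r=1}^{n}\gcd(k_1\cdots k_r,n)$. Let $\overline{\phi}(n):=\phi(n)/n$, where $\phi$ is Euler's totient function, and let $\mathbf{1}$ denote the constant function $\mathbf{1}(n)=1$. Then, with $*$ the Dirichlet convolution and $\overline{\phi}A_{r-1}$ the pointwise product, $A_r=\overline{\phi}A_{r-1}*\mathbf{1}$ for every $r\in\mathbb{N}$. Consequently $A_1=\overline{\phi}*\mathbf{1}$, $A_2=\overline{\phi}(\overline{\phi}*\mathbf{1})*\mathbf{1}$, $A_3=\overline{\phi}(\overline{\phi}(\overline{\phi}*\mathbf{1})*\mathbf{1})*\mathbf{1}$, and in general \[ A_r=\overline{\phi}(\overline{\phi}(\ldots(\overline{\phi}*\mathbf{1})\ldots)*\mathbf{1})*\mathbf{1}, \] containing $r$ factors $\overline{\phi}$ and $r$ factors $\mathbf{1}$.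
   Context: The Dirichlet convolution of arithmetic functions $f,g$ is $(f*g)(n)=\sum_{d\mid n}f(d)g(n/d)$. -}

module Defs where

open import Data.Nat as ℕ using (ℕ; zero; suc; _*_; _^_)
import Data.Nat.Properties
open import Data.Nat.GCD using (gcd)
open import Data.Nat.Divisibility using (_∣?_)
open import Data.Integer using (+_)
open import Data.Rational as ℚ using (ℚ; _/_)
open import Data.List using (List; filter; map; upTo; length)
import Data.List as List
open import Data.Nat.ListAction using (sum)
open import Relation.Nullary.Decidable using (⌊_⌋)

-- An arithmetic function with rational values (values at 0 are irrelevant;
-- all statements are made for n ≥ 1).
ArithFun : Set
ArithFun = ℕ → ℚ

range1 : ℕ → List ℕ
range1 n = map suc (upTo n)

sumℚ : List ℚ → ℚ
sumℚ = List.foldr ℚ._+_ ℚ.0ℚ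

φ : ℕ → ℕ
φ n = length (filter (λ k → gcd k n ℕ.≟ 1) (range1 n))

φbar : ArithFun
φbar zero    = ℚ.0ℚ
φbar (suc m) = (+ φ (suc m)) / suc m

𝟏 : ArithFun
𝟏 _ = ℚ.1ℚ

-- tupleSum r n c = Σ_{k₁,…,k_r = 1}^{n} gcd(c · k₁ ⋯ k_r , n)
-- so that tupleSum r n 1 = Σ_{k₁..k_r=1}^n gcd(k₁⋯k_r, n)   (empty product = 1)
tupleSum : ℕ → ℕ → ℕ → ℕ
tupleSum zero    n c = gcd c n
tupleSum (suc r) n c = sum (map (λ k → tupleSum r n (c * k)) (range1 n))

A : ℕ → ArithFun
A zero    _       = ℚ.1ℚ
A (suc r) zero    = ℚ.0ℚ
A (suc r) (suc m) = (+ tupleSum (suc r) (suc m) 1) / (suc m ^ suc r)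
  where instance _ = Data.Nat.Properties.m^n≢0 (suc m) (suc r)

_·_ : ArithFun → ArithFun → ArithFun
(f · g) n = f n ℚ.* g n

-- Dirichlet convolution (f * g)(n) = Σ_{d ∣ n} f(d) g(n/d), for n ≥ 1
-- (divisors d = j+1 for j < n with (j+1) ∣ n; n/d is the exact ℕ quotient)
infixl 7 _⊛_
_⊛_ : ArithFun → ArithFun → ArithFun
(f ⊛ g) zero    = ℚ.0ℚ
(f ⊛ g) (suc m) =
  sumℚ (map (λ j → f (suc j) ℚ.* g (suc m ℕ./ suc j))
            (filter (λ j → suc j ∣? suc m) (upTo (suc m))))

-- Write G(c) = Σ_{k₁,…,k_r ≤ N} gcd(c k₁⋯k_r, N), so that N^{r+1} A_{r+1}(N) = Σ_{k ≤ N} G(k).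
-- Group k by its additive order d = N / gcd(k, N) in ℤ/N: the k of order d are exactly
-- k = j·(N/d) with 1 ≤ j ≤ d and j coprime to d.  For such k the factor N/d comes out of every
-- gcd, each remaining summand has period d in every kᵢ, and the unit j does not change gcds
-- modulo d, so G(k) = (N/d)^{r+1} · d^r A_r(d).  Hence
-- N^{r+1} A_{r+1}(N) = Σ_{d ∣ N} φ(d) d^r A_r(d) (N/d)^{r+1}, which is the convolution
-- identity after dividing by N^{r+1}.
module Submission where

open import Defs
open import Data.Nat as ℕ using (ℕ; zero; suc; _+_; _*_; _^_; _≤_; _<_; z≤n; s≤s; NonZero)
open import Data.Nat.Properties
open import Data.Nat.Coprimality using (Coprime; coprime-divisor)
open import Data.Nat.Divisibility
  using ( _∣_; _∣?_; divides; ∣-antisym; ∣-trans; ∣⇒≤; ∣1⇒≡1; ∣m∣n⇒∣m+n; ∣m+n∣m⇒∣n; ∣n⇒∣m*n; n∣m*n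
        ; m∣n⇒n≡m*quotient)
open import Data.Nat.DivMod using (m/n*n≡m)
open import Data.Nat.GCD using (gcd; gcd[m,n]∣m; gcd[m,n]∣n; gcd-greatest; c*gcd[m,n]≡gcd[cm,cn]; gcd-zeroˡ)
open import Data.Nat.ListAction using (sum)
open import Data.Nat.ListAction.Properties using (sum-++)
import Data.Integer as ℤ
import Data.Integer.Properties as ℤ
open import Data.Integer.Tactic.RingSolver using (solve-∀)
open import Data.Rational as ℚ using (ℚ; _/_; fromℚᵘ)
import Data.Rational.Properties as ℚ
import Data.Rational.Unnormalised as ℚᵘ
import Data.Rational.Unnormalised.Properties as ℚᵘ
open import Data.List using ([]; _∷_; [_]; _++_; filter; map; upTo; length)
open import Data.List.Properties using (upTo-∷ʳ; map-++; map-∘)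
open import Data.Product using (_,_)
open import Data.Empty using (⊥-elim)
open import Relation.Nullary using (Dec; yes; no; ¬_)
open import Relation.Binary.PropositionalEquality hiding ([_])
open import Algebra.Properties.CommutativeSemigroup +-commutativeSemigroup
  using () renaming (interchange to +-interchange)
open import Algebra.Properties.CommutativeSemigroup *-commutativeSemigroup
  using () renaming (interchange to *-interchange)
open ≡-Reasoning

when : ∀ {P : Set} → Dec P → ℕ → ℕ
when (yes _) x = x
when (no _)  _ = 0

when-cong : ∀ {P : Set} (p : Dec P) {x y} → (P → x ≡ y) → when p x ≡ when p y
when-cong (yes q) x≡y = x≡y q
when-cong (no _)  _   = refl

when-⇔ : ∀ {P Q : Set} (p : Dec P) (q : Dec Q) x → (P → Q) → (Q → P) → when p x ≡ when q x
when-⇔ (yes _) (yes _) x _   _   = refl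
when-⇔ (yes a) (no ¬b) x P→Q _   = ⊥-elim (¬b (P→Q a))
when-⇔ (no ¬a) (yes b) x _   Q→P = ⊥-elim (¬a (Q→P b))
when-⇔ (no _)  (no _)  x _   _   = refl

when-¬ : ∀ {P : Set} (p : Dec P) x → ¬ P → when p x ≡ 0
when-¬ (yes q) x ¬q = ⊥-elim (¬q q)
when-¬ (no _)  x _  = refl

when≡*when1 : ∀ {P : Set} (p : Dec P) x → when p x ≡ x * when p 1
when≡*when1 (yes _) x = sym (*-identityʳ x)
when≡*when1 (no _)  x = sym (*-zeroʳ x)

∑ : ℕ → (ℕ → ℕ) → ℕ
∑ zero    f = 0
∑ (suc n) f = ∑ n f + f (suc n)

infix 5 ∑
syntax ∑ n (λ k → e) = ∑[ k ≤ n ] e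

∑-cong : ∀ n {f g : ℕ → ℕ} → (∀ k → f k ≡ g k) → ∑ n f ≡ ∑ n g
∑-cong zero    f≗g = refl
∑-cong (suc n) f≗g = cong₂ _+_ (∑-cong n f≗g) (f≗g (suc n))

∑-cong-≤ : ∀ n {f g : ℕ → ℕ} → (∀ k → 1 ≤ k → k ≤ n → f k ≡ g k) → ∑ n f ≡ ∑ n g
∑-cong-≤ zero    f≗g = refl
∑-cong-≤ (suc n) f≗g = cong₂ _+_
  (∑-cong-≤ n (λ k 1≤k k≤n → f≗g k 1≤k (m≤n⇒m≤1+n k≤n)))
  (f≗g (suc n) (s≤s z≤n) ≤-refl)

∑-0 : ∀ n → ∑[ k ≤ n ] 0 ≡ 0
∑-0 zero    = refl
∑-0 (suc n) = cong (_+ 0) (∑-0 n)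

∑-+ : ∀ n (f g : ℕ → ℕ) → ∑[ k ≤ n ] (f k + g k) ≡ ∑ n f + ∑ n g
∑-+ zero    f g = refl
∑-+ (suc n) f g = trans
  (cong (_+ (f (suc n) + g (suc n))) (∑-+ n f g))
  (+-interchange (∑ n f) (∑ n g) (f (suc n)) (g (suc n)))

∑-*ˡ : ∀ n a (f : ℕ → ℕ) → ∑[ k ≤ n ] (a * f k) ≡ a * ∑ n f
∑-*ˡ zero    a f = sym (*-zeroʳ a)
∑-*ˡ (suc n) a f = trans
  (cong (_+ a * f (suc n)) (∑-*ˡ n a f))
  (sym (*-distribˡ-+ a (∑ n f) (f (suc n))))

∑-comm : ∀ m n (F : ℕ → ℕ → ℕ) → ∑[ k ≤ m ] ∑ n (F k) ≡ ∑[ d ≤ n ] ∑[ k ≤ m ] F k d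
∑-comm zero    n F = sym (∑-0 n)
∑-comm (suc m) n F = trans
  (cong (_+ ∑ n (F (suc m))) (∑-comm m n F))
  (sym (∑-+ n (λ d → ∑[ k ≤ m ] F k d) (F (suc m))))

∑-split : ∀ a b (f : ℕ → ℕ) → ∑ (a + b) f ≡ ∑ a f + (∑[ k ≤ b ] f (a + k))
∑-split a zero    f = trans (cong (λ n → ∑ n f) (+-identityʳ a)) (sym (+-identityʳ _))
∑-split a (suc b) f = begin
  ∑ (a + suc b) f                                 ≡⟨ cong (λ n → ∑ n f) (+-suc a b) ⟩
  ∑ (a + b) f + f (suc (a + b))                   ≡⟨ cong₂ _+_ (∑-split a b f) (cong f (sym (+-suc a b))) ⟩
  ∑ a f + (∑[ k ≤ b ] f (a + k)) + f (a + suc b)  ≡⟨ +-assoc (∑ a f) _ _ ⟩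
  ∑ a f + ((∑[ k ≤ b ] f (a + k)) + f (a + suc b)) ∎

∑-periodic : ∀ e d (f : ℕ → ℕ) → (∀ k → f (d + k) ≡ f k) → ∑ (e * d) f ≡ e * ∑ d f
∑-periodic zero    d f per = refl
∑-periodic (suc e) d f per = begin
  ∑ (d + e * d) f                     ≡⟨ ∑-split d (e * d) f ⟩
  ∑ d f + (∑[ k ≤ e * d ] f (d + k))  ≡⟨ cong (∑ d f +_) (∑-cong (e * d) per) ⟩
  ∑ d f + ∑ (e * d) f                 ≡⟨ cong (∑ d f +_) (∑-periodic e d f per) ⟩
  ∑ d f + e * ∑ d f                   ∎

∑-multiples : ∀ d e .{{_ : NonZero e}} (f : ℕ → ℕ) → (∀ k → ¬ (e ∣ k) → f k ≡ 0) →
              ∑ (d * e) f ≡ ∑[ j ≤ d ] f (j * e)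
∑-multiples zero    e f off = refl
∑-multiples (suc d) e@(suc e-1) f off = begin
  ∑ (e + d * e) f                                            ≡⟨ cong (λ n → ∑ n f) (+-comm e (d * e)) ⟩
  ∑ (d * e + e) f                                            ≡⟨ ∑-split (d * e) e f ⟩
  ∑ (d * e) f + ((∑[ k ≤ e-1 ] f (d * e + k)) + f (d * e + e))
    ≡⟨ cong₂ (λ u v → u + (v + f (d * e + e))) (∑-multiples d e f off) strictly-between ⟩
  (∑[ j ≤ d ] f (j * e)) + (0 + f (d * e + e))              ≡⟨ cong (λ n → (∑[ j ≤ d ] f (j * e)) + f n) (+-comm (d * e) e) ⟩
  (∑[ j ≤ d ] f (j * e)) + f (e + d * e)                    ∎
  where
  not-multiple : ∀ k → 1 ≤ k → k ≤ e-1 → ¬ (e ∣ d * e + k)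
  not-multiple k@(suc _) _ k<e e∣ = <-irrefl refl (≤-<-trans (∣⇒≤ (∣m+n∣m⇒∣n e∣ (n∣m*n d))) (s≤s k<e))
  strictly-between : ∑[ k ≤ e-1 ] f (d * e + k) ≡ 0
  strictly-between = trans (∑-cong-≤ e-1 λ k 1≤k k<e → off (d * e + k) (not-multiple k 1≤k k<e)) (∑-0 e-1)

∑-indicator-beyond : ∀ n a x → n < a → ∑[ d ≤ n ] when (a ℕ.≟ d) x ≡ 0
∑-indicator-beyond zero    a x _   = refl
∑-indicator-beyond (suc n) a x n<a = cong₂ _+_
  (∑-indicator-beyond n a x (<-trans (n<1+n n) n<a))
  (when-¬ (a ℕ.≟ suc n) x λ a≡1+n → <-irrefl (sym a≡1+n) n<a)

∑-indicator : ∀ n a x → 1 ≤ a → a ≤ n → ∑[ d ≤ n ] when (a ℕ.≟ d) x ≡ x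
∑-indicator zero    (suc _) x _ ()
∑-indicator (suc n) a x 1≤a a≤n with a ℕ.≟ suc n
... | yes refl  = cong (_+ x) (∑-indicator-beyond n (suc n) x ≤-refl)
... | no  a≢1+n = trans (+-identityʳ _) (∑-indicator n a x 1≤a (m<1+n⇒m≤n (≤∧≢⇒< a≤n a≢1+n)))

∑-fibres : ∀ n (g f : ℕ → ℕ) → (∀ k → 1 ≤ g k) → (∀ k → g k ≤ n) →
           ∑ n f ≡ ∑[ d ≤ n ] ∑[ k ≤ n ] when (g k ℕ.≟ d) (f k)
∑-fibres n g f 1≤g g≤n = begin
  ∑ n f                                         ≡⟨ ∑-cong n (λ k → sym (∑-indicator n (g k) (f k) (1≤g k) (g≤n k))) ⟩
  ∑[ k ≤ n ] ∑[ d ≤ n ] when (g k ℕ.≟ d) (f k)  ≡⟨ ∑-comm n n (λ k d → when (g k ℕ.≟ d) (f k)) ⟩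
  ∑[ d ≤ n ] ∑[ k ≤ n ] when (g k ℕ.≟ d) (f k)  ∎

gcd[m+k*n,n]≡gcd[m,n] : ∀ m k n → gcd (m + k * n) n ≡ gcd m n
gcd[m+k*n,n]≡gcd[m,n] m k n = ∣-antisym
  (gcd-greatest (∣m+n∣m⇒∣n g∣k*n+m (∣n⇒∣m*n k g∣n)) g∣n)
  (gcd-greatest (∣m∣n⇒∣m+n (gcd[m,n]∣m m n) (∣n⇒∣m*n k (gcd[m,n]∣n m n))) (gcd[m,n]∣n m n))
  where
  g∣n : gcd (m + k * n) n ∣ n
  g∣n = gcd[m,n]∣n (m + k * n) n
  g∣k*n+m : gcd (m + k * n) n ∣ k * n + m
  g∣k*n+m = subst (gcd (m + k * n) n ∣_) (+-comm m (k * n)) (gcd[m,n]∣m (m + k * n) n)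

gcd[j*m,n]≡gcd[m,n] : ∀ j m n → gcd j n ≡ 1 → gcd (j * m) n ≡ gcd m n
gcd[j*m,n]≡gcd[m,n] j m n gcd[j,n]≡1 = ∣-antisym
  (gcd-greatest (coprime-divisor g⊥j (gcd[m,n]∣m (j * m) n)) (gcd[m,n]∣n (j * m) n))
  (gcd-greatest (∣n⇒∣m*n j (gcd[m,n]∣m m n)) (gcd[m,n]∣n m n))
  where
  g⊥j : Coprime (gcd (j * m) n) j
  g⊥j {i} (i∣g , i∣j) =
    ∣1⇒≡1 (subst (i ∣_) gcd[j,n]≡1 (gcd-greatest i∣j (∣-trans i∣g (gcd[m,n]∣n (j * m) n))))

gcd[j*e,e*d]≡gcd[j,d]*e : ∀ j e d → gcd (j * e) (e * d) ≡ gcd j d * e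
gcd[j*e,e*d]≡gcd[j,d]*e j e d = begin
  gcd (j * e) (e * d)  ≡⟨ cong (λ m → gcd m (e * d)) (*-comm j e) ⟩
  gcd (e * j) (e * d)  ≡⟨ sym (c*gcd[m,n]≡gcd[cm,cn] e j d) ⟩
  e * gcd j d          ≡⟨ *-comm e (gcd j d) ⟩
  gcd j d * e          ∎

-- gcdSum r K M c = Σ_{k₁,…,k_r ≤ K} gcd (c k₁ ⋯ k_r, M).  Separating the range K from the
-- modulus M is what lets the scaling and periodicity lemmas below be stated.
gcdSum : ℕ → ℕ → ℕ → ℕ → ℕ
gcdSum zero    K M c = gcd c M
gcdSum (suc r) K M c = ∑[ k ≤ K ] gcdSum r K M (c * k)

gcdSum-periodic : ∀ r K M c t → gcdSum r K M (c + t * M) ≡ gcdSum r K M c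
gcdSum-periodic zero    K M c t = gcd[m+k*n,n]≡gcd[m,n] c t M
gcdSum-periodic (suc r) K M c t = ∑-cong K λ k →
  trans (cong (gcdSum r K M) (shift k)) (gcdSum-periodic r K M (c * k) (t * k))
  where
  shift : ∀ k → (c + t * M) * k ≡ c * k + t * k * M
  shift k = begin
    (c + t * M) * k    ≡⟨ *-distribʳ-+ k c (t * M) ⟩
    c * k + t * M * k  ≡⟨ cong (c * k +_) (*-assoc t M k) ⟩
    c * k + t * (M * k) ≡⟨ cong (λ m → c * k + t * m) (*-comm M k) ⟩
    c * k + t * (k * M) ≡⟨ cong (c * k +_) (sym (*-assoc t k M)) ⟩
    c * k + t * k * M  ∎

gcdSum-range-* : ∀ r e d c → gcdSum r (e * d) d c ≡ e ^ r * gcdSum r d d c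
gcdSum-range-* zero    e d c = sym (+-identityʳ _)
gcdSum-range-* (suc r) e d c = begin
  gcdSum (suc r) (e * d) d c                      ≡⟨ ∑-cong (e * d) (λ k → gcdSum-range-* r e d (c * k)) ⟩
  ∑[ k ≤ e * d ] e ^ r * gcdSum r d d (c * k)     ≡⟨ ∑-*ˡ (e * d) (e ^ r) _ ⟩
  e ^ r * (∑[ k ≤ e * d ] gcdSum r d d (c * k))   ≡⟨ cong (e ^ r *_) (∑-periodic e d _ per) ⟩
  e ^ r * (e * gcdSum (suc r) d d c)              ≡⟨ sym (*-assoc (e ^ r) e _) ⟩
  e ^ r * e * gcdSum (suc r) d d c                ≡⟨ cong (_* gcdSum (suc r) d d c) (*-comm (e ^ r) e) ⟩
  e ^ suc r * gcdSum (suc r) d d c                ∎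
  where
  per : ∀ k → gcdSum r d d (c * (d + k)) ≡ gcdSum r d d (c * k)
  per k = trans (cong (gcdSum r d d) (trans (*-distribˡ-+ c d k) (+-comm (c * d) (c * k))))
                (gcdSum-periodic r d d (c * k) c)

gcdSum-scale : ∀ r K e M c → gcdSum r K (e * M) (e * c) ≡ e * gcdSum r K M c
gcdSum-scale zero    K e M c = sym (c*gcd[m,n]≡gcd[cm,cn] e c M)
gcdSum-scale (suc r) K e M c = trans
  (∑-cong K λ k → trans (cong (gcdSum r K (e * M)) (*-assoc e c k)) (gcdSum-scale r K e M (c * k)))
  (∑-*ˡ K e _)

gcdSum-coprime-* : ∀ r K M j c → gcd j M ≡ 1 → gcdSum r K M (j * c) ≡ gcdSum r K M c
gcdSum-coprime-* zero    K M j c j⊥M = gcd[j*m,n]≡gcd[m,n] j c M j⊥M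
gcdSum-coprime-* (suc r) K M j c j⊥M = ∑-cong K λ k →
  trans (cong (gcdSum r K M) (*-assoc j c k)) (gcdSum-coprime-* r K M j (c * k) j⊥M)

gcdSum-unit-multiple : ∀ r e d j → gcd j d ≡ 1 →
  gcdSum r (e * d) (e * d) (j * e) ≡ e ^ suc r * gcdSum r d d 1
gcdSum-unit-multiple r e d j j⊥d = begin
  gcdSum r (e * d) (e * d) (j * e)  ≡⟨ cong (gcdSum r (e * d) (e * d)) (*-comm j e) ⟩
  gcdSum r (e * d) (e * d) (e * j)  ≡⟨ gcdSum-scale r (e * d) e d j ⟩
  e * gcdSum r (e * d) d j          ≡⟨ cong (e *_) (gcdSum-range-* r e d j) ⟩
  e * (e ^ r * gcdSum r d d j)      ≡⟨ sym (*-assoc e (e ^ r) _) ⟩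
  e ^ suc r * gcdSum r d d j        ≡⟨ cong (λ c → e ^ suc r * gcdSum r d d c) (sym (*-identityʳ j)) ⟩
  e ^ suc r * gcdSum r d d (j * 1)  ≡⟨ cong (e ^ suc r *_) (gcdSum-coprime-* r d d j 1 j⊥d) ⟩
  e ^ suc r * gcdSum r d d 1        ∎

_//_ : ℕ → ℕ → ℕ
n // zero  = 0
n // suc d = n ℕ./ suc d

//-*-cancel : ∀ {n d} → d ∣ n → (n // d) * d ≡ n
//-*-cancel {d = zero}  d∣n = sym (m∣n⇒n≡m*quotient d∣n)
//-*-cancel {d = suc d} d∣n = m/n*n≡m d∣n

-- The additive order of k in ℤ/Nℤ.
order : ℕ → ℕ → ℕ
order N k = N // gcd k N

order*gcd≡ : ∀ N k → order N k * gcd k N ≡ N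
order*gcd≡ N k = //-*-cancel (gcd[m,n]∣n k N)

order∣ : ∀ N k → order N k ∣ N
order∣ N k = divides (gcd k N) (trans (sym (order*gcd≡ N k)) (*-comm (order N k) (gcd k N)))

order-fibre : ∀ N d e .{{_ : NonZero d}} .{{_ : NonZero e}} → e * d ≡ N → ∀ (f : ℕ → ℕ) →
  ∑[ k ≤ N ] when (order N k ℕ.≟ d) (f k) ≡ ∑[ j ≤ d ] when (gcd j d ℕ.≟ 1) (f (j * e))
order-fibre N d e e*d≡N f = begin
  ∑[ k ≤ N ] when (order N k ℕ.≟ d) (f k)      ≡⟨ ∑-cong N order≡d⇔gcd≡e ⟩
  ∑ N h                                        ≡⟨ cong (λ n → ∑ n h) (trans (sym e*d≡N) (*-comm e d)) ⟩
  ∑ (d * e) h                                  ≡⟨ ∑-multiples d e h h-off ⟩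
  ∑[ j ≤ d ] h (j * e)                         ≡⟨ ∑-cong d gcd≡e⇔coprime ⟩
  ∑[ j ≤ d ] when (gcd j d ℕ.≟ 1) (f (j * e))  ∎
  where
  h : ℕ → ℕ
  h k = when (gcd k N ℕ.≟ e) (f k)
  order≡⇒gcd≡ : ∀ k → order N k ≡ d → gcd k N ≡ e
  order≡⇒gcd≡ k refl = *-cancelʳ-≡ (gcd k N) e d
    (trans (*-comm (gcd k N) d) (trans (order*gcd≡ N k) (sym e*d≡N)))
  gcd≡⇒order≡ : ∀ k → gcd k N ≡ e → order N k ≡ d
  gcd≡⇒order≡ k refl = *-cancelʳ-≡ (order N k) d e
    (trans (order*gcd≡ N k) (trans (sym e*d≡N) (*-comm e d)))
  h-off : ∀ k → ¬ (e ∣ k) → h k ≡ 0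
  h-off k e∤k = when-¬ (gcd k N ℕ.≟ e) (f k) λ gcd≡e → e∤k (subst (_∣ k) gcd≡e (gcd[m,n]∣m k N))
  gcd[j*e,N]≡gcd[j,d]*e : ∀ j → gcd (j * e) N ≡ gcd j d * e
  gcd[j*e,N]≡gcd[j,d]*e j = trans (cong (gcd (j * e)) (sym e*d≡N)) (gcd[j*e,e*d]≡gcd[j,d]*e j e d)
  gcd≡e⇒coprime : ∀ j → gcd (j * e) N ≡ e → gcd j d ≡ 1
  gcd≡e⇒coprime j eq =
    *-cancelʳ-≡ (gcd j d) 1 e (trans (sym (gcd[j*e,N]≡gcd[j,d]*e j)) (trans eq (sym (*-identityˡ e))))
  coprime⇒gcd≡e : ∀ j → gcd j d ≡ 1 → gcd (j * e) N ≡ e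
  coprime⇒gcd≡e j eq = trans (gcd[j*e,N]≡gcd[j,d]*e j) (trans (cong (_* e) eq) (*-identityˡ e))
  order≡d⇔gcd≡e : ∀ k → when (order N k ℕ.≟ d) (f k) ≡ h k
  order≡d⇔gcd≡e k = when-⇔ (order N k ℕ.≟ d) (gcd k N ℕ.≟ e) (f k) (order≡⇒gcd≡ k) (gcd≡⇒order≡ k)
  gcd≡e⇔coprime : ∀ j → h (j * e) ≡ when (gcd j d ℕ.≟ 1) (f (j * e))
  gcd≡e⇔coprime j =
    when-⇔ (gcd (j * e) N ℕ.≟ e) (gcd j d ℕ.≟ 1) (f (j * e)) (gcd≡e⇒coprime j) (coprime⇒gcd≡e j)

order-fibre-empty : ∀ N d (f : ℕ → ℕ) → ¬ (d ∣ N) → ∑[ k ≤ N ] when (order N k ℕ.≟ d) (f k) ≡ 0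
order-fibre-empty N d f d∤N =
  trans (∑-cong N λ k → when-¬ (order N k ℕ.≟ d) (f k) λ { refl → d∤N (order∣ N k) }) (∑-0 N)

∑-by-order : ∀ N (f : ℕ → ℕ) →
  ∑ N f ≡ ∑[ d ≤ N ] when (d ∣? N) (∑[ j ≤ d ] when (gcd j d ℕ.≟ 1) (f (j * (N // d))))
∑-by-order zero      f = refl
∑-by-order N@(suc _) f = trans (∑-fibres N (order N) f 1≤order order≤N) (∑-cong N fibre)
  where
  1≤order : ∀ k → 1 ≤ order N k
  1≤order k = n≢0⇒n>0 λ order≡0 → 0≢1+n (trans (cong (_* gcd k N) (sym order≡0)) (order*gcd≡ N k))
  order≤N : ∀ k → order N k ≤ N
  order≤N k = ∣⇒≤ (order∣ N k)
  fibre : ∀ d → ∑[ k ≤ N ] when (order N k ℕ.≟ d) (f k)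
              ≡ when (d ∣? N) (∑[ j ≤ d ] when (gcd j d ℕ.≟ 1) (f (j * (N // d))))
  fibre d with d ∣? N
  ... | no d∤N = order-fibre-empty N d f d∤N
  ... | yes d∣N with d | N // d | //-*-cancel d∣N
  ...   | suc _ | suc _ | e*d≡N = order-fibre N _ _ e*d≡N f
  ...   | zero  | e     | e*0≡N = ⊥-elim (0≢1+n (trans (sym (*-zeroʳ e)) e*0≡N))
  ...   | suc _ | zero  | 0≡N  = ⊥-elim (0≢1+n 0≡N)

sum-map-upTo : ∀ n (f : ℕ → ℕ) → sum (map (λ k → f (suc k)) (upTo n)) ≡ ∑ n f
sum-map-upTo zero    f = refl
sum-map-upTo (suc n) f = begin
  sum (map f′ (upTo (suc n)))         ≡⟨ cong (λ ks → sum (map f′ ks)) (sym (upTo-∷ʳ n)) ⟩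
  sum (map f′ (upTo n ++ [ n ]))      ≡⟨ cong sum (map-++ f′ (upTo n) [ n ]) ⟩
  sum (map f′ (upTo n) ++ [ f′ n ])   ≡⟨ sum-++ (map f′ (upTo n)) [ f′ n ] ⟩
  sum (map f′ (upTo n)) + (f′ n + 0)  ≡⟨ cong₂ _+_ (sum-map-upTo n f) (+-identityʳ (f′ n)) ⟩
  ∑ n f + f (suc n)                   ∎
  where
  f′ : ℕ → ℕ
  f′ k = f (suc k)

sum-map-range1 : ∀ n (f : ℕ → ℕ) → sum (map f (range1 n)) ≡ ∑ n f
sum-map-range1 n f = trans (cong sum (sym (map-∘ (upTo n)))) (sum-map-upTo n f)

length-filter : ∀ {P : ℕ → Set} (p : ∀ k → Dec (P k)) ks →
  length (filter p ks) ≡ sum (map (λ k → when (p k) 1) ks)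
length-filter p []       = refl
length-filter p (k ∷ ks) with p k
... | yes _ = cong suc (length-filter p ks)
... | no _  = length-filter p ks

φ≡∑-coprime : ∀ d → φ d ≡ ∑[ j ≤ d ] when (gcd j d ℕ.≟ 1) 1
φ≡∑-coprime d = trans (length-filter (λ k → gcd k d ℕ.≟ 1) (range1 d)) (sum-map-range1 d _)

∑-coprime-const : ∀ d C (f : ℕ → ℕ) → (∀ j → gcd j d ≡ 1 → f j ≡ C) →
  ∑[ j ≤ d ] when (gcd j d ℕ.≟ 1) (f j) ≡ φ d * C
∑-coprime-const d C f f≡C = begin
  ∑[ j ≤ d ] when (gcd j d ℕ.≟ 1) (f j)
    ≡⟨ ∑-cong d (λ j → trans (when-cong (gcd j d ℕ.≟ 1) (f≡C j)) (when≡*when1 (gcd j d ℕ.≟ 1) C)) ⟩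
  ∑[ j ≤ d ] C * when (gcd j d ℕ.≟ 1) 1    ≡⟨ ∑-*ˡ d C _ ⟩
  C * (∑[ j ≤ d ] when (gcd j d ℕ.≟ 1) 1)  ≡⟨ cong (C *_) (sym (φ≡∑-coprime d)) ⟩
  C * φ d                                  ≡⟨ *-comm C (φ d) ⟩
  φ d * C                                  ∎

tupleSum≡gcdSum : ∀ r n c → tupleSum r n c ≡ gcdSum r n n c
tupleSum≡gcdSum zero    n c = refl
tupleSum≡gcdSum (suc r) n c =
  trans (sum-map-range1 n _) (∑-cong n λ k → tupleSum≡gcdSum r n (c * k))

gcdSum≡∑-divisors : ∀ r N → gcdSum (suc r) N N 1 ≡
  ∑[ d ≤ N ] when (d ∣? N) (φ d * gcdSum r d d 1 * (N // d) ^ suc r)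
gcdSum≡∑-divisors r N = begin
  ∑[ k ≤ N ] gcdSum r N N (1 * k)  ≡⟨ ∑-cong N (λ k → cong (gcdSum r N N) (*-identityˡ k)) ⟩
  ∑ N (gcdSum r N N)               ≡⟨ ∑-by-order N (gcdSum r N N) ⟩
  ∑[ d ≤ N ] when (d ∣? N) (∑[ j ≤ d ] when (gcd j d ℕ.≟ 1) (gcdSum r N N (j * (N // d))))
    ≡⟨ ∑-cong N (λ d → when-cong (d ∣? N) (divisor-term d)) ⟩
  ∑[ d ≤ N ] when (d ∣? N) (φ d * gcdSum r d d 1 * (N // d) ^ suc r) ∎
  where
  divisor-term : ∀ d → d ∣ N → ∑[ j ≤ d ] when (gcd j d ℕ.≟ 1) (gcdSum r N N (j * (N // d)))
                                ≡ φ d * gcdSum r d d 1 * (N // d) ^ suc r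
  divisor-term d d∣N = begin
    ∑[ j ≤ d ] when (gcd j d ℕ.≟ 1) (gcdSum r N N (j * e))  ≡⟨ ∑-coprime-const d _ _ unit-multiple ⟩
    φ d * (e ^ suc r * gcdSum r d d 1)                     ≡⟨ cong (φ d *_) (*-comm (e ^ suc r) _) ⟩
    φ d * (gcdSum r d d 1 * e ^ suc r)                     ≡⟨ sym (*-assoc (φ d) _ _) ⟩
    φ d * gcdSum r d d 1 * e ^ suc r                       ∎
    where
    e : ℕ
    e = N // d
    unit-multiple : ∀ j → gcd j d ≡ 1 → gcdSum r N N (j * e) ≡ e ^ suc r * gcdSum r d d 1
    unit-multiple j j⊥d = trans
      (cong (λ n → gcdSum r n n (j * e)) (sym (//-*-cancel d∣N)))
      (gcdSum-unit-multiple r e d j j⊥d)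

-- On numerators and denominators ℚᵘ's operations are syntactic, so fraction arithmetic is
-- done there and transported along fromℚᵘ.
fromℚᵘ-homo-+ : ∀ p q → fromℚᵘ (p ℚᵘ.+ q) ≡ fromℚᵘ p ℚ.+ fromℚᵘ q
fromℚᵘ-homo-+ p q = ℚ.toℚᵘ-injective (ℚᵘ.≃-trans (ℚ.toℚᵘ-fromℚᵘ (p ℚᵘ.+ q)) (ℚᵘ.≃-sym (ℚᵘ.≃-trans
  (ℚ.toℚᵘ-homo-+ (fromℚᵘ p) (fromℚᵘ q))
  (ℚᵘ.+-cong (ℚ.toℚᵘ-fromℚᵘ p) (ℚ.toℚᵘ-fromℚᵘ q)))))

fromℚᵘ-homo-* : ∀ p q → fromℚᵘ (p ℚᵘ.* q) ≡ fromℚᵘ p ℚ.* fromℚᵘ q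
fromℚᵘ-homo-* p q = ℚ.toℚᵘ-injective (ℚᵘ.≃-trans (ℚ.toℚᵘ-fromℚᵘ (p ℚᵘ.* q)) (ℚᵘ.≃-sym (ℚᵘ.≃-trans
  (ℚ.toℚᵘ-homo-* (fromℚᵘ p) (fromℚᵘ q))
  (ℚᵘ.*-cong (ℚ.toℚᵘ-fromℚᵘ p) (ℚ.toℚᵘ-fromℚᵘ q)))))

a/n+b/n≡[a+b]/n : ∀ a b n .{{_ : NonZero n}} → ℤ.+ a / n ℚ.+ ℤ.+ b / n ≡ ℤ.+ (a + b) / n
a/n+b/n≡[a+b]/n a b n@(suc _) = trans
  (sym (fromℚᵘ-homo-+ (ℤ.+ a ℚᵘ./ n) (ℤ.+ b ℚᵘ./ n)))
  (ℚ.fromℚᵘ-cong {ℤ.+ a ℚᵘ./ n ℚᵘ.+ ℤ.+ b ℚᵘ./ n} {ℤ.+ (a + b) ℚᵘ./ n} (ℚᵘ.*≡* cross))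
  where
  distrib : ∀ x y z → (x ℤ.* z ℤ.+ y ℤ.* z) ℤ.* z ≡ (x ℤ.+ y) ℤ.* (z ℤ.* z)
  distrib = solve-∀
  cross : (ℤ.+ a ℤ.* ℤ.+ n ℤ.+ ℤ.+ b ℤ.* ℤ.+ n) ℤ.* ℤ.+ n ≡ ℤ.+ (a + b) ℤ.* ℤ.+ (n * n)
  cross = trans (distrib (ℤ.+ a) (ℤ.+ b) (ℤ.+ n)) (sym (cong₂ ℤ._*_ (ℤ.pos-+ a b) (ℤ.pos-* n n)))

a/m*b/n≡[a*b]/[m*n] : ∀ a b m n .{{_ : NonZero m}} .{{_ : NonZero n}} →
  (ℤ.+ a / m) ℚ.* (ℤ.+ b / n) ≡ (ℤ.+ (a * b) / (m * n)) {{m*n≢0 m n}}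
a/m*b/n≡[a*b]/[m*n] a b m@(suc _) n@(suc _) =
  trans (sym (fromℚᵘ-homo-* (ℤ.+ a ℚᵘ./ m) (ℤ.+ b ℚᵘ./ n))) (ℚ./-cong (sym (ℤ.pos-* a b)) refl)

a*n≡b*m⇒a/m≡b/n : ∀ a b m n .{{_ : NonZero m}} .{{_ : NonZero n}} →
  a * n ≡ b * m → ℤ.+ a / m ≡ ℤ.+ b / n
a*n≡b*m⇒a/m≡b/n a b m@(suc _) n@(suc _) a*n≡b*m = ℚ.fromℚᵘ-cong {ℤ.+ a ℚᵘ./ m} {ℤ.+ b ℚᵘ./ n}
  (ℚᵘ.*≡* (trans (sym (ℤ.pos-* a n)) (trans (cong ℤ.+_ a*n≡b*m) (ℤ.pos-* b m))))

sumℚ-filter : ∀ {P : ℕ → Set} (p : ∀ j → Dec (P j)) (g : ℕ → ℚ) (x : ℕ → ℕ) Q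
  .{{_ : NonZero Q}} →
  (∀ j → P j → g j ≡ ℤ.+ x j / Q) → ∀ js →
  sumℚ (map g (filter p js)) ≡ ℤ.+ sum (map (λ j → when (p j) (x j)) js) / Q
sumℚ-filter p g x Q g≡x/Q []       = sym (ℚ.0/n≡0 Q)
sumℚ-filter p g x Q g≡x/Q (j ∷ js) with p j
... | yes pj = trans
  (cong₂ ℚ._+_ (g≡x/Q j pj) (sumℚ-filter p g x Q g≡x/Q js))
  (a/n+b/n≡[a+b]/n (x j) _ Q)
... | no _   = sumℚ-filter p g x Q g≡x/Q js

^-distribʳ-* : ∀ m n k → (m * n) ^ k ≡ m ^ k * n ^ k
^-distribʳ-* m n zero    = refl
^-distribʳ-* m n (suc k) =
  trans (cong (m * n *_) (^-distribʳ-* m n k)) (*-interchange m n (m ^ k) (n ^ k))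

A≡gcdSum/ : ∀ r n .{{_ : NonZero n}} → A r n ≡ (ℤ.+ gcdSum r n n 1 / n ^ r) {{m^n≢0 n r}}
A≡gcdSum/ zero    n@(suc _) rewrite gcd-zeroˡ n = refl
A≡gcdSum/ (suc r) n@(suc _) =
  cong (λ s → (ℤ.+ s / n ^ suc r) {{m^n≢0 n (suc r)}}) (tupleSum≡gcdSum (suc r) n 1)

convolution-term : ∀ r N d .{{_ : NonZero N}} .{{_ : NonZero d}} → d ∣ N →
  φbar d ℚ.* A r d ≡ (ℤ.+ (φ d * gcdSum r d d 1 * (N // d) ^ suc r) / N ^ suc r) {{m^n≢0 N (suc r)}}
convolution-term r N d@(suc _) d∣N = begin
  φbar d ℚ.* A r d                                 ≡⟨ cong (φbar d ℚ.*_) (A≡gcdSum/ r d) ⟩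
  (ℤ.+ φ d / d) ℚ.* (ℤ.+ u / d ^ r) {{m^n≢0 d r}}  ≡⟨ a/m*b/n≡[a*b]/[m*n] (φ d) u d (d ^ r) {{_}} {{m^n≢0 d r}} ⟩
  (ℤ.+ (φ d * u) / d ^ suc r) {{m^n≢0 d (suc r)}}
    ≡⟨ a*n≡b*m⇒a/m≡b/n (φ d * u) (φ d * u * e ^ suc r) (d ^ suc r) (N ^ suc r)
         {{m^n≢0 d (suc r)}} {{m^n≢0 N (suc r)}} cross ⟩
  (ℤ.+ (φ d * u * e ^ suc r) / N ^ suc r) {{m^n≢0 N (suc r)}} ∎
  where
  u e : ℕ
  u = gcdSum r d d 1
  e = N // d
  cross : φ d * u * N ^ suc r ≡ φ d * u * e ^ suc r * d ^ suc r
  cross = begin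
    φ d * u * N ^ suc r                ≡⟨ cong (λ n → φ d * u * n ^ suc r) (sym (//-*-cancel d∣N)) ⟩
    φ d * u * (e * d) ^ suc r          ≡⟨ cong (φ d * u *_) (^-distribʳ-* e d (suc r)) ⟩
    φ d * u * (e ^ suc r * d ^ suc r)  ≡⟨ sym (*-assoc (φ d * u) _ _) ⟩
    φ d * u * e ^ suc r * d ^ suc r    ∎

corollary1 : ∀ (r n : ℕ) → A (suc r) (suc n) ≡ ((φbar · A r) ⊛ 𝟏) (suc n)
corollary1 r n = begin
  A (suc r) N                                  ≡⟨ A≡gcdSum/ (suc r) N ⟩
  ℤ.+ gcdSum (suc r) N N 1 / Q                 ≡⟨ cong (λ s → ℤ.+ s / Q) (gcdSum≡∑-divisors r N) ⟩
  ℤ.+ (∑[ d ≤ N ] when (d ∣? N) (x d)) / Q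
    ≡⟨ cong (λ s → ℤ.+ s / Q) (sym (sum-map-upTo N λ d → when (d ∣? N) (x d))) ⟩
  ℤ.+ sum (map (λ j → when (suc j ∣? N) (x (suc j))) (upTo N)) / Q
    ≡⟨ sym (sumℚ-filter (λ j → suc j ∣? N) _ (λ j → x (suc j)) Q term (upTo N)) ⟩
  ((φbar · A r) ⊛ 𝟏) N                         ∎
  where
  N Q : ℕ
  N = suc n
  Q = N ^ suc r
  instance
    Q≢0 : NonZero Q
    Q≢0 = m^n≢0 N (suc r)
  x : ℕ → ℕ
  x d = φ d * gcdSum r d d 1 * (N // d) ^ suc r
  term : ∀ j → suc j ∣ N → (φbar (suc j) ℚ.* A r (suc j)) ℚ.* 𝟏 (N ℕ./ suc j) ≡ ℤ.+ x (suc j) / Q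
  term j dj∣N = trans (ℚ.*-identityʳ _) (convolution-term r N (suc j) dj∣N)
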